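{- Let $(\mathbf{A},\mathbf{B})$ be a promise template over finite domains such that $\operatorname{Pol}(\mathbf{A},\mathbf{B})$ contains block-symmetric polymorphisms of arbitrarily large width (i.e. for every $N$ there is a polymorphism of width at least $N$). Then the BLP+Affine algorithm correctly solves $\operatorname{PCSP-Decision}(\mathbf{A},\mathbf{B})$: it accepts every instance satisfiable in $\mathbf{A}$ and rejects every instance not satisfiable in $\mathbf{B}$.
   Context: A signature $\tau$ is a set of symbols $R$, each with a positive integer arity $\operatorname{ar}(R)$. A relational structure $\mathbf{A}$ with signature $\tau$ consists of a finite domain $A$ and relations $R^{\mathbf{A}}\subseteq A^{\operatorname{ar}(R)}$ for $R\in\tau$. A homomorphism $\mathbf{A}\to\mathbf{B}$ is a map $\sigma:A\to B$ with $\sigma(R^{\mathbf{A}})\subseteq R^{\mathbf{B}}$ for all $R\in\tau$ (componentwise). A promise template $(\mathbf{A},\mathbf{B})$ is a pair of such structures with the same signature such that a homomorphism $\mathbf{A}\to\mathbf{B}$ exists. An instance $\mathbf{X}$ consists of variables $x_1,\dots,x_n$ and constraints $c_j=(R_j,\bar x^j)$, $j\in[m]$, with $R_j\in\tau$ and $\bar x^j$ a tuple of variables of length $\operatorname{ar}(R_j)$. $\mathbf{X}$ is satisfiable in $\mathbf{C}$ if some assignment $\sigma$ of values in $C$ to variables has $\sigma(\bar x^j)\in R_j^{\mathbf{C}}$ for all $j$. $\operatorname{PCSP-Decision}(\mathbf{A},\mathbf{B})$: distinguish instances satisfiable in $\mathbf{A}$ from instances not satisfiable in $\mathbf{B}$.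 A polymorphism of $(\mathbf{A},\mathbf{B})$ of arity $L$ is a map $f:A^L\to B$ such that for every $R\in\tau$ and all $x^{(1)},\dots,x^{(L)}\in R^{\mathbf{A}}$, the tuple obtained by applying $f$ coordinatewise, $(f(x^{(1)}_t,\dots,x^{(L)}_t))_{t=1}^{\operatorname{ar}(R)}$, lies in $R^{\mathbf{B}}$. $\operatorname{Pol}(\mathbf{A},\mathbf{B})$ is the set of all polymorphisms. A map $f:A^L\to B$ is block-symmetric with respect to a partition $[L]=B_1\cup\dots\cup B_k$ if $f$ is invariant under every permutation of coordinates that maps each block $B_i$ to itself. The width of $f$ is the maximum, over all partitions with respect to which $f$ is block-symmetric, of the minimum block size. Basic LP $\operatorname{LP}_{\mathbb{Q}}(\mathbf{X},\mathbf{A})$: rational variables $w_i(a)$ ($i\in[n],a\in A$), $p_j(y)$ ($j\in[m]$, $y\in R_j^{\mathbf{A}}$) with $w_i(a)\ge0$, $p_j(y)\ge0$, $\sum_a w_i(a)=1$, $\sum_{y}p_j(y)=1$, and $\sum_{y\in R_j^{\mathbf{A}},\,y|_i=a}p_j(y)=w_i(a)$ for all $i,a,j$ with $x_i$ occurring in $\bar x^j$ ($y|_i=a$ meaning the coordinate of $y$ at the position of $x_i$ in $\bar x^j$ is $a$). Affine relaxation $\operatorname{Aff}_{\mathbb{Z}}(\mathbf{X},\mathbf{A})$: integer variables $r_i(a)$, $q_j(y)$ satisfying the same equalities (no nonnegativity). BLP+Affine algorithm: (1) If $\operatorname{LP}_{\mathbb{Q}}(\mathbf{X},\mathbf{A})$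 is infeasible, reject; otherwise take a relative interior point $(w,p)$ (a feasible point where each coordinate is positive iff it is positive at some feasible point). (2) Form $\operatorname{Aff}'_{\mathbb{Z}}(\mathbf{X},\mathbf{A})$ by adding to $\operatorname{Aff}_{\mathbb{Z}}(\mathbf{X},\mathbf{A})$ the constraints $r_i(a)=0$ whenever $w_i(a)=0$ and $q_j(y)=0$ whenever $p_j(y)=0$. (3) If $\operatorname{Aff}'_{\mathbb{Z}}(\mathbf{X},\mathbf{A})$ has no integer solution, reject; else accept. It correctly solves $\operatorname{PCSP-Decision}(\mathbf{A},\mathbf{B})$ if it accepts every instance satisfiable in $\mathbf{A}$ and rejects every instance not satisfiable in $\mathbf{B}$. -}

module Defs where

open import Level using (0ℓ)
open import Data.Nat as ℕ using (ℕ; zero; suc; _≥_)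
open import Data.Fin as Fin using (Fin)
open import Data.Fin.Permutation using (Permutation′; _⟨$⟩ʳ_)
open import Data.Vec as Vec using (Vec; []; _∷_; lookup; tabulate)
open import Data.List as List using (List; []; _∷_; [_]; filter; allFin; concatMap; foldr; length)
open import Data.Product using (Σ; ∃; _×_; _,_)
open import Data.Rational as ℚ using (ℚ; 0ℚ; 1ℚ)
open import Data.Integer as ℤ using (ℤ)
open import Relation.Nullary using (¬_; Dec)
open import Relation.Nullary.Decidable using (_×-dec_)
open import Relation.Binary.PropositionalEquality using (_≡_)

record Signature : Set₁ where
  field
    Sym : Set
    ar  : Sym → ℕ
open Signature public

record Structure (τ : Signature) : Set₁ where
  field
    size : ℕ
    rel  : (R : Sym τ) → Vec (Fin size) (ar τ R) → Set
    rel? : (R : Sym τ) (y : Vec (Fin size) (ar τ R)) → Dec (rel R y)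
open Structure public

blockSize : {L k : ℕ} → (Fin L → Fin k) → Fin k → ℕ
blockSize {L} blk i = length (filter (λ l → blk l Fin.≟ i) (allFin L))

IsPartition : {L k : ℕ} → (Fin L → Fin k) → Set
IsPartition blk = ∀ i → blockSize blk i ≥ 1

IsBlockSymmetric : {X Y : Set} {L k : ℕ} → ((Fin L → X) → Y) → (Fin L → Fin k) → Set
IsBlockSymmetric {L = L} f blk =
  ∀ (π : Permutation′ L) → (∀ l → blk (π ⟨$⟩ʳ l) ≡ blk l) →
  ∀ x → f (λ l → x (π ⟨$⟩ʳ l)) ≡ f x

WidthAtLeast : {X Y : Set} {L : ℕ} → ((Fin L → X) → Y) → ℕ → Set
WidthAtLeast {L = L} f N =
  ∃ λ k → Σ (Fin L → Fin (suc k)) λ blk →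
    IsPartition blk × IsBlockSymmetric f blk × (∀ i → blockSize blk i ≥ N)


module _ {τ : Signature} where

  Dom : Structure τ → Set
  Dom A = Fin (size A)

  IsHom : (A B : Structure τ) → (Dom A → Dom B) → Set
  IsHom A B σ = ∀ (R : Sym τ) (x : Vec (Dom A) (ar τ R)) →
                rel A R x → rel B R (Vec.map σ x)

  IsPromiseTemplate : Structure τ → Structure τ → Set
  IsPromiseTemplate A B = Σ (Dom A → Dom B) (IsHom A B)

  IsPolymorphism : (A B : Structure τ) (L : ℕ) → ((Fin L → Dom A) → Dom B) → Set
  IsPolymorphism A B L f =
    ∀ (R : Sym τ) (xs : Fin L → Vec (Dom A) (ar τ R)) →
    (∀ l → rel A R (xs l)) →
    rel B R (tabulate (λ t → f (λ l → lookup (xs l) t)))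

  record Instance : Set where
    field
      nvars : ℕ
      ncons : ℕ
      sym   : Fin ncons → Sym τ
      scope : (j : Fin ncons) → Vec (Fin nvars) (ar τ (sym j))
  open Instance public

  SatisfiableIn : Instance → Structure τ → Set
  SatisfiableIn X C = Σ (Fin (nvars X) → Dom C) λ σ →
    ∀ j → rel C (sym X j) (Vec.map σ (scope X j))

  allVecs : (d k : ℕ) → List (Vec (Fin d) k)
  allVecs d zero    = [ [] ]
  allVecs d (suc k) = concatMap (λ a → List.map (a ∷_) (allVecs d k)) (allFin d)

  sumℚ : List ℚ → ℚ
  sumℚ = foldr ℚ._+_ 0ℚ

  sumℤ : List ℤ → ℤ
  sumℤ = foldr ℤ._+_ (ℤ.+ 0)

  module _ (X : Instance) (A : Structure τ) where

    tuples : (R : Sym τ) → List (Vec (Dom A) (ar τ R))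
    tuples R = filter (rel? A R) (allVecs (size A) (ar τ R))

    tuplesAt : (R : Sym τ) → Fin (ar τ R) → Dom A → List (Vec (Dom A) (ar τ R))
    tuplesAt R t a =
      filter (λ y → rel? A R y ×-dec (lookup y t Fin.≟ a)) (allVecs (size A) (ar τ R))

    -- Variables of the relaxations: w i a, and p j y for y ∈ R_j^A.
    -- p j y is only meaningful for y ∈ R_j^A and is required to be 0 otherwise.
    WVars : Set → Set
    WVars S = Fin (nvars X) → Dom A → S

    PVars : Set → Set
    PVars S = (j : Fin (ncons X)) → Vec (Dom A) (ar τ (sym X j)) → S

    IsLPSolution : WVars ℚ → PVars ℚ → Set
    IsLPSolution w p =
        (∀ i a → 0ℚ ℚ.≤ w i a)
      × (∀ j y → 0ℚ ℚ.≤ p j y)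
      × (∀ j y → ¬ rel A (sym X j) y → p j y ≡ 0ℚ)
      × (∀ i → sumℚ (List.map (w i) (allFin (size A))) ≡ 1ℚ)
      × (∀ j → sumℚ (List.map (p j) (tuples (sym X j))) ≡ 1ℚ)
      × (∀ j t a → sumℚ (List.map (p j) (tuplesAt (sym X j) t a))
                    ≡ w (lookup (scope X j) t) a)

    LPFeasible : Set
    LPFeasible = Σ (WVars ℚ) λ w → Σ (PVars ℚ) λ p → IsLPSolution w p

    IsRelIntPoint : WVars ℚ → PVars ℚ → Set
    IsRelIntPoint w p =
        IsLPSolution w p
      × (∀ i a → (0ℚ ℚ.< w i a →
                    Σ (WVars ℚ) λ w′ → Σ (PVars ℚ) λ p′ → IsLPSolution w′ p′ × 0ℚ ℚ.< w′ i a)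
               × ((Σ (WVars ℚ) λ w′ → Σ (PVars ℚ) λ p′ → IsLPSolution w′ p′ × 0ℚ ℚ.< w′ i a) →
                    0ℚ ℚ.< w i a))
      × (∀ j y → (0ℚ ℚ.< p j y →
                    Σ (WVars ℚ) λ w′ → Σ (PVars ℚ) λ p′ → IsLPSolution w′ p′ × 0ℚ ℚ.< p′ j y)
               × ((Σ (WVars ℚ) λ w′ → Σ (PVars ℚ) λ p′ → IsLPSolution w′ p′ × 0ℚ ℚ.< p′ j y) →
                    0ℚ ℚ.< p j y))

    -- Affine relaxation over ℤ (same equalities, no nonnegativity;
    -- q j y exists only for y ∈ R_j^A, so it is 0 otherwise)
    IsAffSolution : WVars ℤ → PVars ℤ → Set
    IsAffSolution r q =
        (∀ j y → ¬ rel A (sym X j) y → q j y ≡ ℤ.+ 0)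
      × (∀ i → sumℤ (List.map (r i) (allFin (size A))) ≡ ℤ.+ 1)
      × (∀ j → sumℤ (List.map (q j) (tuples (sym X j))) ≡ ℤ.+ 1)
      × (∀ j t a → sumℤ (List.map (q j) (tuplesAt (sym X j) t a))
                    ≡ r (lookup (scope X j) t) a)

    AffRestrictedSolvable : WVars ℚ → PVars ℚ → Set
    AffRestrictedSolvable w p =
      Σ (WVars ℤ) λ r → Σ (PVars ℤ) λ q →
          IsAffSolution r q
        × (∀ i a → w i a ≡ 0ℚ → r i a ≡ ℤ.+ 0)
        × (∀ j y → p j y ≡ 0ℚ → q j y ≡ ℤ.+ 0)

  -- BLP+Affine correctly solves PCSP-Decision(A,B), whichever relative
  -- interior point is chosen in step (1):
  --  * instances satisfiable in A: LP feasible, and Aff' solvable for every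
  --    relative interior point (so the algorithm accepts);
  --  * instances not satisfiable in B: for every relative interior point
  --    Aff' is unsolvable (and if LP is infeasible it rejects in step (1)).
  BLPAffSolves : Structure τ → Structure τ → Set
  BLPAffSolves A B =
    ∀ (X : Instance) →
      (SatisfiableIn X A →
          LPFeasible X A
        × (∀ w p → IsRelIntPoint X A w p → AffRestrictedSolvable X A w p))
    × (¬ SatisfiableIn X B →
        ∀ w p → IsRelIntPoint X A w p → ¬ AffRestrictedSolvable X A w p)

module Submission where

-- Completeness: a satisfying assignment in A yields, through its indicator vectors, an integral
-- solution of both relaxations, and its support lies inside that of every relative-interior LP point.
--
-- Soundness: scaling an LP solution by a common denominator D gives a nonnegative integral solution
-- of mass D of the homogenised affine relaxation, and Aff′ gives an integral solution of mass 1
-- supported inside it. For n = αD + β with 0 ≤ β < D and α large, α·(first) + β·(second) is a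
-- nonnegative integral solution of mass n. Take a block-symmetric polymorphism f all of whose blocks
-- are that large, and realise in each block a solution whose mass is the block size: every variable x
-- gets a column c_x with prescribed value counts on each block, every constraint gets a matrix whose
-- rows are tuples of R^A with prescribed multiplicities on each block. By the marginal equations each
-- column of a constraint matrix has the same per-block value counts as c_x for its variable x, hence
-- is c_x permuted within blocks, and block symmetry makes x ↦ f(c_x) a solution in B.


open import Algebra.Bundles using (Monoid)
import Algebra.Properties.Monoid.Sum as MonoidSum
import Algebra.Properties.Semiring.Sum as SemiringSum
open import Data.Bool.Base using (true; false; if_then_else_)
open import Data.Nat.Base as ℕ using (ℕ; zero; suc; _+_; _*_; _∸_; _≤_; _<_; z≤n; s≤s)
import Data.Nat.Properties as ℕ
import Data.Nat.ListAction as ℕ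
import Data.Nat.ListAction.Properties as ℕ
import Data.Nat.DivMod as DivMod
open import Data.Nat.Divisibility using (_∣_; divides; ∣-trans; m∣m*n; n∣m*n)
import Data.Nat.Tactic.RingSolver as ℕ-RingSolver
open import Data.Integer.Base as ℤ using (ℤ; +_; -[1+_]; 0ℤ) renaming (_+_ to _+ᶻ_; _*_ to _*ᶻ_)
import Data.Integer.Properties as ℤ
import Data.Integer.Tactic.RingSolver as ℤ-RingSolver
open import Data.Rational.Base as ℚ using (ℚ; mkℚ; 0ℚ; 1ℚ; ↥_; ↧ₙ_; toℚᵘ)
import Data.Rational.Properties as ℚ
open import Data.Rational.Unnormalised.Base as ℚᵘ using (mkℚᵘ; *≡*)
import Data.Rational.Unnormalised.Properties as ℚᵘ
open import Data.Fin as Fin using (Fin; punchIn)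
open import Data.Fin.Properties using (punchInᵢ≢i)
open import Data.Fin.Permutation as Perm using (Permutation; Permutation′; _⟨$⟩ʳ_)
open import Data.Fin.Instances
open import Data.Vec.Base as Vec using (Vec; []; _∷_; lookup)
open import Data.Vec.Instances
import Data.Vec.Properties as Vec
open import Data.List.Base as List using (List; []; _∷_; _++_; map; foldr; filter; length; allFin)
import Data.List.Properties as List
open import Data.Product.Base using (Σ; ∃; _×_; _,_; proj₁; proj₂)
open import Data.Product.Instances
open import Data.Product.Properties using (,-injectiveˡ; ,-injectiveʳ)
open import Data.Sum.Base using ([_,_]′)
open import Function.Base using (id; _∘_)
open import Function.Bundles using (_⇔_; mk⇔; module Equivalence)
open import Relation.Nullary using (¬_; Dec; yes; no; does; contradiction)
open import Relation.Nullary.Decidable using (_×-dec_; decidable-stable)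
open import Relation.Unary using (Pred; Decidable)
open import Relation.Binary.PropositionalEquality
open import Relation.Binary.Structures using (IsDecEquivalence)
open import Relation.Binary.TypeClasses using (_≟_)

open import Defs renaming (sym to symbolOf)

open SemiringSum ℕ.+-*-semiring
  using (sum; sum-cong-≗; sum-remove; ∑-distrib-+; ∑-comm; *-distribˡ-sum; *-distribʳ-sum; sum-replicate-zero)
open SemiringSum ℤ.+-*-semiring using ()
  renaming (sum to sumᶻ; sum-cong-≗ to sum-cong-≗ᶻ; ∑-distrib-+ to ∑-distrib-+ᶻ; *-distribˡ-sum to *-distribˡ-sumᶻ)
open MonoidSum ℕ.*-1-monoid using () renaming (sum to ∏)

module _ {E : Set} {{_ : IsDecEquivalence {A = E} _≡_}} where

  δ : E → E → ℕ
  δ x y = if does (x ≟ y) then 1 else 0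

  δ-refl : ∀ x → δ x x ≡ 1
  δ-refl x with x ≟ x
  ... | yes _  = refl
  ... | no x≢x = contradiction refl x≢x

  δ-≢ : ∀ {x y} → x ≢ y → δ x y ≡ 0
  δ-≢ {x} {y} x≢y with x ≟ y
  ... | yes x≡y = contradiction x≡y x≢y
  ... | no _    = refl

  1≤δ⇒≡ : ∀ {x y} → 1 ≤ δ x y → x ≡ y
  1≤δ⇒≡ {x} {y} 1≤δ with x ≟ y
  ... | yes x≡y = x≡y
  1≤δ⇒≡ () | no _

  δ-sym : ∀ x y → δ x y ≡ δ y x
  δ-sym x y with x ≟ y | y ≟ x
  ... | yes _   | yes _   = refl
  ... | no _    | no _    = refl
  ... | yes x≡y | no y≢x  = contradiction (sym x≡y) y≢x
  ... | no x≢y  | yes y≡x = contradiction (sym y≡x) x≢y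

  δ≤ : ∀ {x y} (g : E → ℕ) → 1 ≤ g x → δ x y ≤ g y
  δ≤ {x} {y} g 1≤gx with x ≟ y
  ... | yes refl = 1≤gx
  ... | no _     = z≤n

  δ-*-subst : ∀ x y (g : E → ℕ) → δ x y * g x ≡ δ x y * g y
  δ-*-subst x y g with x ≟ y
  ... | yes refl = refl
  ... | no _     = refl

δ-injective₂ : ∀ {X Y Z : Set} {{_ : IsDecEquivalence {A = X} _≡_}} {{_ : IsDecEquivalence {A = Y} _≡_}}
               {{_ : IsDecEquivalence {A = Z} _≡_}} (f : X → Y → Z) →
               (∀ {x x′ y y′} → f x y ≡ f x′ y′ → x ≡ x′ × y ≡ y′) →
               ∀ x x′ y y′ → δ (f x y) (f x′ y′) ≡ δ x x′ * δ y y′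
δ-injective₂ f f-injective x x′ y y′ = cases (x ≟ x′) (y ≟ y′)
  where
  cases : Dec (x ≡ x′) → Dec (y ≡ y′) → δ (f x y) (f x′ y′) ≡ δ x x′ * δ y y′
  cases (yes x≡x′) (yes y≡y′) = begin
    δ (f x y) (f x′ y′) ≡⟨ cong (δ (f x y)) (cong₂ f x≡x′ y≡y′) ⟨
    δ (f x y) (f x y)   ≡⟨ δ-refl (f x y) ⟩
    1 * 1               ≡⟨ cong₂ _*_ (δ-refl x) (δ-refl y) ⟨
    δ x x * δ y y       ≡⟨ cong₂ _*_ (cong (δ x) x≡x′) (cong (δ y) y≡y′) ⟩
    δ x x′ * δ y y′     ∎
    where open ≡-Reasoning
  cases (yes _) (no y≢y′) =
    trans (δ-≢ (y≢y′ ∘ proj₂ ∘ f-injective)) (sym (trans (cong (δ x x′ *_) (δ-≢ y≢y′)) (ℕ.*-zeroʳ (δ x x′))))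
  cases (no x≢x′) _ = trans (δ-≢ (x≢x′ ∘ proj₁ ∘ f-injective)) (sym (cong (_* δ y y′) (δ-≢ x≢x′)))

δ-× : ∀ {X Y : Set} {{_ : IsDecEquivalence {A = X} _≡_}} {{_ : IsDecEquivalence {A = Y} _≡_}}
      (x x′ : X) (y y′ : Y) → δ (x , y) (x′ , y′) ≡ δ x x′ * δ y y′
δ-× = δ-injective₂ _,_ λ eq → ,-injectiveˡ eq , ,-injectiveʳ eq

sum-δ : ∀ {n} (k : Fin n) (f : Fin n → ℕ) → sum (λ i → δ k i * f i) ≡ f k
sum-δ {suc n} k f = begin
  sum (λ i → δ k i * f i)
    ≡⟨ sum-remove {i = k} (λ i → δ k i * f i) ⟩
  δ k k * f k + sum (λ j → δ k (punchIn k j) * f (punchIn k j))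
    ≡⟨ cong₂ _+_ (cong (_* f k) (δ-refl k))
                 (sum-cong-≗ λ j → cong (_* f (punchIn k j)) (δ-≢ (punchInᵢ≢i k j ∘ sym))) ⟩
  1 * f k + sum (λ (_ : Fin n) → 0)
    ≡⟨ cong₂ _+_ (ℕ.*-identityˡ (f k)) (sum-replicate-zero n) ⟩
  f k + 0
    ≡⟨ ℕ.+-identityʳ (f k) ⟩
  f k ∎
  where open ≡-Reasoning

sum-δ-1 : ∀ {n} (k : Fin n) → sum (δ k) ≡ 1
sum-δ-1 k = trans (sum-cong-≗ λ i → sym (ℕ.*-identityʳ (δ k i))) (sum-δ k (λ _ → 1))

summand≤sum : ∀ {n} (f : Fin n → ℕ) i → f i ≤ sum f
summand≤sum f Fin.zero    = ℕ.m≤m+n _ _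
summand≤sum f (Fin.suc i) = ℕ.≤-trans (summand≤sum (f ∘ Fin.suc) i) (ℕ.m≤n+m _ _)

1≤sum⇒∃1≤summand : ∀ {n} (f : Fin n → ℕ) → 1 ≤ sum f → ∃ λ i → 1 ≤ f i
1≤sum⇒∃1≤summand {suc n} f 1≤Σ with f Fin.zero in f₀≡
... | suc _ = Fin.zero , subst (1 ≤_) (sym f₀≡) (s≤s z≤n)
... | zero  = let i , 1≤fi = 1≤sum⇒∃1≤summand (f ∘ Fin.suc) 1≤Σ in Fin.suc i , 1≤fi

pos-sum : ∀ {n} (f : Fin n → ℕ) → + sum f ≡ sumᶻ (λ i → + f i)
pos-sum {zero}  f = refl
pos-sum {suc n} f = trans (ℤ.pos-+ (f Fin.zero) _) (cong (+ f Fin.zero +ᶻ_) (pos-sum (f ∘ Fin.suc)))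

module _ {E : Set} {{_ : IsDecEquivalence {A = E} _≡_}} where

  count : ∀ {n} → (Fin n → E) → E → ℕ
  count g e = sum (λ l → δ (g l) e)

  count-self : ∀ {n} (g : Fin n → E) l → 1 ≤ count g (g l)
  count-self g l = ℕ.≤-trans (ℕ.≤-reflexive (sym (δ-refl (g l)))) (summand≤sum (λ l′ → δ (g l′) (g l)) l)

  equal-counts⇒permutation : ∀ {m n} (g : Fin m → E) (h : Fin n → E) → (∀ e → count g e ≡ count h e) →
                             Σ (Permutation n m) λ π → ∀ l → g (π ⟨$⟩ʳ l) ≡ h l
  equal-counts⇒permutation {zero}  {zero}  g h _  = Perm.id , λ ()
  equal-counts⇒permutation {suc m} {zero}  g h eq
    with () ← ℕ.≤-trans (count-self g Fin.zero) (ℕ.≤-reflexive (eq (g Fin.zero)))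
  equal-counts⇒permutation {zero}  {suc n} g h eq
    with () ← ℕ.≤-trans (count-self h Fin.zero) (ℕ.≤-reflexive (sym (eq (h Fin.zero))))
  equal-counts⇒permutation {suc m} {suc n} g h eq = Perm.insert Fin.zero i π , g∘π≡h
    where
    h₀ : E
    h₀ = h Fin.zero
    i-found : ∃ λ i → 1 ≤ δ (g i) h₀
    i-found = 1≤sum⇒∃1≤summand (λ l → δ (g l) h₀) (ℕ.≤-trans (count-self h Fin.zero) (ℕ.≤-reflexive (sym (eq h₀))))
    i : Fin (suc m)
    i = proj₁ i-found
    gi≡h₀ : g i ≡ h₀
    gi≡h₀ = 1≤δ⇒≡ (proj₂ i-found)
    eq′ : ∀ e → count (g ∘ punchIn i) e ≡ count (h ∘ Fin.suc) e
    eq′ e = ℕ.+-cancelˡ-≡ (δ h₀ e) _ _ (begin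
      δ h₀ e + count (g ∘ punchIn i) e ≡⟨ cong (λ x → δ x e + count (g ∘ punchIn i) e) gi≡h₀ ⟨
      δ (g i) e + count (g ∘ punchIn i) e ≡⟨ sum-remove {i = i} (λ l → δ (g l) e) ⟨
      count g e ≡⟨ eq e ⟩
      δ h₀ e + count (h ∘ Fin.suc) e ∎)
      where open ≡-Reasoning
    rest : Σ (Permutation n m) λ π → ∀ l → g (punchIn i (π ⟨$⟩ʳ l)) ≡ h (Fin.suc l)
    rest = equal-counts⇒permutation (g ∘ punchIn i) (h ∘ Fin.suc) eq′
    π : Permutation n m
    π = proj₁ rest
    g∘π≡h : ∀ l → g (Perm.insert Fin.zero i π ⟨$⟩ʳ l) ≡ h l
    g∘π≡h Fin.zero    = gi≡h₀
    g∘π≡h (Fin.suc l) = trans (cong g (Perm.insert-punchIn Fin.zero i π l)) (proj₂ rest l)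


joint-count-∘ : ∀ {L M} {X Y : Set} {{_ : IsDecEquivalence {A = X} _≡_}} {{_ : IsDecEquivalence {A = Y} _≡_}}
                (h : Fin L → X) (y : Fin L → Fin M) (G : Fin M → Y) x a →
                count (λ l → h l , G (y l)) (x , a) ≡ sum (λ m → δ (G m) a * count (λ l → h l , y l) (x , m))
joint-count-∘ h y G x a = sym (begin
  sum (λ m → δ (G m) a * sum (λ l → δ (h l , y l) (x , m)))
    ≡⟨ sum-cong-≗ (λ m → *-distribˡ-sum (δ (G m) a) (λ l → δ (h l , y l) (x , m))) ⟩
  sum (λ m → sum (λ l → δ (G m) a * δ (h l , y l) (x , m)))
    ≡⟨ ∑-comm (λ m l → δ (G m) a * δ (h l , y l) (x , m)) ⟩
  sum (λ l → sum (λ m → δ (G m) a * δ (h l , y l) (x , m)))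
    ≡⟨ sum-cong-≗ (λ l → sum-cong-≗ (λ m → rearrange l m)) ⟩
  sum (λ l → sum (λ m → δ (y l) m * (δ (h l) x * δ (G m) a)))
    ≡⟨ sum-cong-≗ (λ l → sum-δ (y l) (λ m → δ (h l) x * δ (G m) a)) ⟩
  sum (λ l → δ (h l) x * δ (G (y l)) a)
    ≡⟨ sum-cong-≗ (λ l → δ-× (h l) x (G (y l)) a) ⟨
  count (λ l → h l , G (y l)) (x , a) ∎)
  where
  open ≡-Reasoning
  rearrange : ∀ l m → δ (G m) a * δ (h l , y l) (x , m) ≡ δ (y l) m * (δ (h l) x * δ (G m) a)
  rearrange l m = trans (cong (δ (G m) a *_) (δ-× (h l) x (y l) m))
                        (swap-outer (δ (G m) a) (δ (h l) x) (δ (y l) m))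
    where
    swap-outer : ∀ u v w → u * (v * w) ≡ w * (v * u)
    swap-outer = ℕ-RingSolver.solve-∀

realise-joint-counts : ∀ {L K M} (blk : Fin L → Fin K) (c : Fin K → Fin M → ℕ) →
                       (∀ b → sum (c b) ≡ count blk b) →
                       Σ (Fin L → Fin M) λ y → ∀ b m → count (λ l → blk l , y l) (b , m) ≡ c b m
realise-joint-counts {zero} blk c hc =
  (λ ()) , λ b m → sym (ℕ.n≤0⇒n≡0 (ℕ.≤-trans (summand≤sum (c b) m) (ℕ.≤-reflexive (hc b))))
realise-joint-counts {suc L} {K} {M} blk c hc = y , counts
  where
  b₀ : Fin K
  b₀ = blk Fin.zero
  m₀-found : ∃ λ m → 1 ≤ c b₀ m
  m₀-found = 1≤sum⇒∃1≤summand (c b₀) (subst (1 ≤_) (sym (hc b₀)) (count-self blk Fin.zero))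
  m₀ : Fin M
  m₀ = proj₁ m₀-found
  -- the first coordinate is sent to (b₀ , m₀); the rest realises c minus that entry
  e : Fin K → Fin M → ℕ
  e b m = δ (b₀ , m₀) (b , m)
  c′ : Fin K → Fin M → ℕ
  c′ b m = c b m ∸ e b m
  e+c′≡c : ∀ b m → e b m + c′ b m ≡ c b m
  e+c′≡c b m = ℕ.m+[n∸m]≡n (δ≤ (λ (b , m) → c b m) (proj₂ m₀-found))
  sum-e : ∀ b → sum (e b) ≡ δ b₀ b
  sum-e b = begin
    sum (e b)                     ≡⟨ sum-cong-≗ (λ m → δ-× b₀ b m₀ m) ⟩
    sum (λ m → δ b₀ b * δ m₀ m)   ≡⟨ *-distribˡ-sum (δ b₀ b) (δ m₀) ⟨
    δ b₀ b * sum (δ m₀)           ≡⟨ cong (δ b₀ b *_) (sum-δ-1 m₀) ⟩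
    δ b₀ b * 1                    ≡⟨ ℕ.*-identityʳ (δ b₀ b) ⟩
    δ b₀ b                        ∎
    where open ≡-Reasoning
  hc′ : ∀ b → sum (c′ b) ≡ count (blk ∘ Fin.suc) b
  hc′ b = ℕ.+-cancelˡ-≡ (δ b₀ b) _ _ (begin
    δ b₀ b + sum (c′ b)            ≡⟨ cong (_+ sum (c′ b)) (sum-e b) ⟨
    sum (e b) + sum (c′ b)         ≡⟨ ∑-distrib-+ (e b) (c′ b) ⟨
    sum (λ m → e b m + c′ b m)     ≡⟨ sum-cong-≗ (e+c′≡c b) ⟩
    sum (c b)                      ≡⟨ hc b ⟩
    count blk b                    ∎)
    where open ≡-Reasoning
  rest : Σ (Fin L → Fin M) λ y → ∀ b m → count (λ l → blk (Fin.suc l) , y l) (b , m) ≡ c′ b m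
  rest = realise-joint-counts (blk ∘ Fin.suc) c′ hc′
  y : Fin (suc L) → Fin M
  y Fin.zero    = m₀
  y (Fin.suc l) = proj₁ rest l
  counts : ∀ b m → count (λ l → blk l , y l) (b , m) ≡ c b m
  counts b m = trans (cong (λ n → e b m + n) (proj₂ rest b m)) (e+c′≡c b m)

module _ {c ℓ} (M : Monoid c ℓ) where
  open Monoid M using (Carrier; _≈_; _∙_; ε; ∙-congˡ; identityˡ)
    renaming (refl to ≈-refl; trans to ≈-trans; sym to ≈-sym)
  open MonoidSum M using () renaming (sum to sumᴹ)

  foldr-map-lookup : ∀ {A : Set} (g : A → Carrier) (l : List A) →
                     foldr _∙_ ε (map g l) ≈ sumᴹ (λ m → g (List.lookup l m))
  foldr-map-lookup g []      = ≈-refl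
  foldr-map-lookup g (x ∷ l) = ∙-congˡ (foldr-map-lookup g l)

  foldr-map-tabulate : ∀ {A : Set} {n} (g : A → Carrier) (h : Fin n → A) →
                       foldr _∙_ ε (map g (List.tabulate h)) ≈ sumᴹ (g ∘ h)
  foldr-map-tabulate {n = zero}  g h = ≈-refl
  foldr-map-tabulate {n = suc n} g h = ∙-congˡ (foldr-map-tabulate g (h ∘ Fin.suc))

  foldr-map-filter : ∀ {A : Set} {p} {P : Pred A p} (P? : Decidable P) (g : A → Carrier) (l : List A) →
                     foldr _∙_ ε (map g (filter P? l)) ≈ foldr _∙_ ε (map (λ x → if does (P? x) then g x else ε) l)
  foldr-map-filter P? g []      = ≈-refl
  foldr-map-filter P? g (x ∷ l) with does (P? x)
  ... | true  = ∙-congˡ (foldr-map-filter P? g l)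
  ... | false = ≈-trans (foldr-map-filter P? g l) (≈-sym (identityˡ _))

module _ {E : Set} {{_ : IsDecEquivalence {A = E} _≡_}} where

  occurrences : List E → E → ℕ
  occurrences l v = ℕ.sum (map (λ u → δ u v) l)

  occurrences-++ : ∀ xs ys v → occurrences (xs ++ ys) v ≡ occurrences xs v + occurrences ys v
  occurrences-++ xs ys v =
    trans (cong ℕ.sum (List.map-++ (λ u → δ u v) xs ys)) (ℕ.sum-++ (map (λ u → δ u v) xs) (map (λ u → δ u v) ys))

  occurrences-concatMap : ∀ {X : Set} (F : X → List E) xs v →
                          occurrences (List.concatMap F xs) v ≡ ℕ.sum (map (λ x → occurrences (F x) v) xs)
  occurrences-concatMap F []       v = refl
  occurrences-concatMap F (x ∷ xs) v =
    trans (occurrences-++ (F x) _ v) (cong (λ n → occurrences (F x) v + n) (occurrences-concatMap F xs v))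

δ-∷ : ∀ {d k} (a b : Fin d) (u v : Vec (Fin d) k) → δ (a ∷ u) (b ∷ v) ≡ δ a b * δ u v
δ-∷ = δ-injective₂ _∷_ Vec.∷-injective

occurrences-map-∷ : ∀ {d k} (a b : Fin d) l (v : Vec (Fin d) k) →
                    occurrences (map (a ∷_) l) (b ∷ v) ≡ δ a b * occurrences l v
occurrences-map-∷ a b []      v = sym (ℕ.*-zeroʳ (δ a b))
occurrences-map-∷ a b (u ∷ l) v =
  trans (cong₂ _+_ (δ-∷ a b u v) (occurrences-map-∷ a b l v)) (sym (ℕ.*-distribˡ-+ (δ a b) _ _))

sumℤ-allFin : ∀ {τ n} (g : Fin n → ℤ) → sumℤ {τ} (map g (List.allFin n)) ≡ sumᶻ g
sumℤ-allFin g = foldr-map-tabulate ℤ.+-0-monoid g id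

module Enumeration {τ : Signature} where

  allVecs-occurrences : ∀ d k (v : Vec (Fin d) k) → occurrences (allVecs {τ} d k) v ≡ 1
  allVecs-occurrences d zero    []      = refl
  allVecs-occurrences d (suc k) (b ∷ v) = begin
    occurrences (List.concatMap (λ a → map (a ∷_) (allVecs {τ} d k)) (List.allFin d)) (b ∷ v)
      ≡⟨ occurrences-concatMap (λ a → map (a ∷_) (allVecs {τ} d k)) (List.allFin d) (b ∷ v) ⟩
    ℕ.sum (map (λ a → occurrences (map (a ∷_) (allVecs {τ} d k)) (b ∷ v)) (List.allFin d))
      ≡⟨ foldr-map-tabulate ℕ.+-0-monoid (λ a → occurrences (map (a ∷_) (allVecs {τ} d k)) (b ∷ v)) id ⟩
    sum (λ a → occurrences (map (a ∷_) (allVecs {τ} d k)) (b ∷ v))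
      ≡⟨ sum-cong-≗ (λ a → trans (occurrences-map-∷ a b (allVecs {τ} d k) v)
                                 (cong (δ a b *_) (allVecs-occurrences d k v))) ⟩
    sum (λ a → δ a b * 1)
      ≡⟨ sum-cong-≗ (λ a → cong (_* 1) (δ-sym a b)) ⟩
    sum (λ a → δ b a * 1)
      ≡⟨ sum-δ b (λ _ → 1) ⟩
    1 ∎
    where open ≡-Reasoning

  nVecs : ℕ → ℕ → ℕ
  nVecs d k = length (allVecs {τ} d k)

  vecAt : ∀ {d k} → Fin (nVecs d k) → Vec (Fin d) k
  vecAt {d} {k} = List.lookup (allVecs {τ} d k)

  count-vecAt : ∀ {d k} (v : Vec (Fin d) k) → count vecAt v ≡ 1
  count-vecAt {d} {k} v =
    trans (sym (foldr-map-lookup ℕ.+-0-monoid (λ u → δ u v) (allVecs {τ} d k))) (allVecs-occurrences d k v)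

  vecAt-surjective : ∀ {d k} (v : Vec (Fin d) k) → ∃ λ m → vecAt m ≡ v
  vecAt-surjective v =
    let m , 1≤δ = 1≤sum⇒∃1≤summand (λ m → δ (vecAt m) v) (ℕ.≤-reflexive (sym (count-vecAt v)))
    in m , 1≤δ⇒≡ 1≤δ

  sum-vecAt-δ : ∀ {d k} (v : Vec (Fin d) k) (g : Vec (Fin d) k → ℕ) →
                sum (λ m → δ (vecAt m) v * g (vecAt m)) ≡ g v
  sum-vecAt-δ v g = begin
    sum (λ m → δ (vecAt m) v * g (vecAt m)) ≡⟨ sum-cong-≗ (λ m → δ-*-subst (vecAt m) v g) ⟩
    sum (λ m → δ (vecAt m) v * g v)         ≡⟨ *-distribʳ-sum (g v) (λ m → δ (vecAt m) v) ⟨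
    count vecAt v * g v                     ≡⟨ cong (_* g v) (count-vecAt v) ⟩
    1 * g v                                 ≡⟨ ℕ.*-identityˡ (g v) ⟩
    g v                                     ∎
    where open ≡-Reasoning

  module _ (X : Instance {τ}) (A : Structure τ) (R : Sym τ)
           (g : Vec (Fin (size A)) (ar τ R) → ℤ) (g-vanishes : ∀ y → ¬ rel A R y → g y ≡ + 0) where

    sumℤ-tuples : sumℤ {τ} (map g (tuples X A R)) ≡ sumᶻ (λ m → g (vecAt m))
    sumℤ-tuples = begin
      sumℤ {τ} (map g (tuples X A R))
        ≡⟨ foldr-map-filter ℤ.+-0-monoid (rel? A R) g (allVecs {τ} (size A) (ar τ R)) ⟩
      sumℤ {τ} (map (λ y → if does (rel? A R y) then g y else + 0) (allVecs {τ} (size A) (ar τ R)))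
        ≡⟨ foldr-map-lookup ℤ.+-0-monoid (λ y → if does (rel? A R y) then g y else + 0) (allVecs {τ} (size A) (ar τ R)) ⟩
      sumᶻ (λ m → if does (rel? A R (vecAt m)) then g (vecAt m) else + 0)
        ≡⟨ sum-cong-≗ᶻ (λ m → restrict (vecAt m)) ⟩
      sumᶻ (λ m → g (vecAt m)) ∎
      where
      open ≡-Reasoning
      restrict : ∀ y → (if does (rel? A R y) then g y else + 0) ≡ g y
      restrict y with rel? A R y
      ... | yes _  = refl
      ... | no ¬Ry = sym (g-vanishes y ¬Ry)

    sumℤ-tuplesAt : ∀ t a → sumℤ {τ} (map g (tuplesAt X A R t a)) ≡
                            sumᶻ (λ m → + δ (Vec.lookup (vecAt m) t) a *ᶻ g (vecAt m))
    sumℤ-tuplesAt t a = begin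
      sumℤ {τ} (map g (tuplesAt X A R t a))
        ≡⟨ foldr-map-filter ℤ.+-0-monoid P? g (allVecs {τ} (size A) (ar τ R)) ⟩
      sumℤ {τ} (map (λ y → if does (P? y) then g y else + 0) (allVecs {τ} (size A) (ar τ R)))
        ≡⟨ foldr-map-lookup ℤ.+-0-monoid (λ y → if does (P? y) then g y else + 0) (allVecs {τ} (size A) (ar τ R)) ⟩
      sumᶻ (λ m → if does (P? (vecAt m)) then g (vecAt m) else + 0)
        ≡⟨ sum-cong-≗ᶻ (λ m → restrict (vecAt m)) ⟩
      sumᶻ (λ m → + δ (Vec.lookup (vecAt m) t) a *ᶻ g (vecAt m)) ∎
      where
      open ≡-Reasoning
      P? : Decidable (λ y → rel A R y × Vec.lookup y t ≡ a)
      P? y = rel? A R y ×-dec (Vec.lookup y t Fin.≟ a)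
      restrict : ∀ y → (if does (P? y) then g y else + 0) ≡ + δ (Vec.lookup y t) a *ᶻ g y
      restrict y with rel? A R y
      ... | no ¬Ry = sym (trans (cong (+ δ (Vec.lookup y t) a *ᶻ_) (g-vanishes y ¬Ry)) (ℤ.*-zeroʳ (+ δ (Vec.lookup y t) a)))
      ... | yes _ with Vec.lookup y t Fin.≟ a
      ...   | yes _ = sym (ℤ.*-identityˡ (g y))
      ...   | no _  = refl

length-filter-tabulate : ∀ {A : Set} {p} {P : Pred A p} (P? : Decidable P) {n} (h : Fin n → A) →
                         length (filter P? (List.tabulate h)) ≡ sum (λ i → if does (P? (h i)) then 1 else 0)
length-filter-tabulate P? {zero}  h = refl
length-filter-tabulate P? {suc n} h with does (P? (h Fin.zero))
... | true  = cong suc (length-filter-tabulate P? (h ∘ Fin.suc))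
... | false = length-filter-tabulate P? (h ∘ Fin.suc)

blockSize≡count : ∀ {L K} (blk : Fin L → Fin K) b → blockSize blk b ≡ count blk b
blockSize≡count blk b = length-filter-tabulate (λ l → blk l Fin.≟ b) id

ι : ℤ → ℚ
ι z = z ℚ./ 1

toℚᵘ-ι : ∀ z → toℚᵘ (ι z) ℚᵘ.≃ mkℚᵘ z 0
toℚᵘ-ι z = ℚ.toℚᵘ-fromℚᵘ (mkℚᵘ z 0)

ι-injective : ∀ {a b} → ι a ≡ ι b → a ≡ b
ι-injective {a} {b} ιa≡ιb
  with ℚᵘ.≃-trans (ℚᵘ.≃-sym (toℚᵘ-ι a)) (ℚᵘ.≃-trans (ℚᵘ.≃-reflexive (cong toℚᵘ ιa≡ιb)) (toℚᵘ-ι b))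
... | *≡* a*1≡b*1 = trans (sym (ℤ.*-identityʳ a)) (trans a*1≡b*1 (ℤ.*-identityʳ b))

ι-+ : ∀ a b → ι (a +ᶻ b) ≡ ι a ℚ.+ ι b
ι-+ a b = ℚ.toℚᵘ-injective (begin
  toℚᵘ (ι (a +ᶻ b))           ≈⟨ toℚᵘ-ι (a +ᶻ b) ⟩
  mkℚᵘ (a +ᶻ b) 0             ≈⟨ *≡* (cong (_*ᶻ + 1) (sym (cong₂ _+ᶻ_ (ℤ.*-identityʳ a) (ℤ.*-identityʳ b)))) ⟩
  mkℚᵘ a 0 ℚᵘ.+ mkℚᵘ b 0      ≈⟨ ℚᵘ.+-cong (toℚᵘ-ι a) (toℚᵘ-ι b) ⟨
  toℚᵘ (ι a) ℚᵘ.+ toℚᵘ (ι b)  ≈⟨ ℚ.toℚᵘ-homo-+ (ι a) (ι b) ⟨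
  toℚᵘ (ι a ℚ.+ ι b)          ∎)
  where open ℚᵘ.≃-Reasoning

0≤ι : ∀ n → 0ℚ ℚ.≤ ι (+ n)
0≤ι n = ℚ.nonNegative⁻¹ (ι (+ n)) {{ℚ.normalize-nonNeg n 1}}

0<ι1 : 0ℚ ℚ.< ι (+ 1)
0<ι1 = ℚ.*<* (ℤ.+<+ (s≤s z≤n))

module _ {τ : Signature} {Y : Set} where

  sumℚ-scaled : ∀ (c : ℚ) (g : Y → ℚ) (G : Y → ℤ) → (∀ y → g y ℚ.* c ≡ ι (G y)) →
                ∀ l → sumℚ {τ} (map g l) ℚ.* c ≡ ι (sumℤ {τ} (map G l))
  sumℚ-scaled c g G g*c≡G []      = ℚ.*-zeroˡ c
  sumℚ-scaled c g G g*c≡G (y ∷ l) = begin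
    (g y ℚ.+ sumℚ {τ} (map g l)) ℚ.* c          ≡⟨ ℚ.*-distribʳ-+ c (g y) _ ⟩
    g y ℚ.* c ℚ.+ sumℚ {τ} (map g l) ℚ.* c      ≡⟨ cong₂ ℚ._+_ (g*c≡G y) (sumℚ-scaled c g G g*c≡G l) ⟩
    ι (G y) ℚ.+ ι (sumℤ {τ} (map G l))          ≡⟨ ι-+ (G y) _ ⟨
    ι (G y +ᶻ sumℤ {τ} (map G l))               ∎
    where open ≡-Reasoning

  sumℚ-ι : ∀ (G : Y → ℤ) l → sumℚ {τ} (map (ι ∘ G) l) ≡ ι (sumℤ {τ} (map G l))
  sumℚ-ι G l = trans (sym (ℚ.*-identityʳ _)) (sumℚ-scaled 1ℚ (ι ∘ G) G (λ y → ℚ.*-identityʳ (ι (G y))) l)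

  sumℤ-scaled : ∀ (c : ℚ) (g : Y → ℚ) (G : Y → ℤ) → (∀ y → g y ℚ.* c ≡ ι (G y)) →
                ∀ l {v V} → sumℚ {τ} (map g l) ≡ v → v ℚ.* c ≡ ι V → sumℤ {τ} (map G l) ≡ V
  sumℤ-scaled c g G g*c≡G l refl v*c≡V = ι-injective (trans (sym (sumℚ-scaled c g G g*c≡G l)) v*c≡V)

-- x · D when the denominator of x divides D; meaningful only for x ≥ 0 (the sign of x is dropped).
scaleℕ : (x : ℚ) (D : ℕ) → ↧ₙ x ∣ D → ℕ
scaleℕ x D (divides k _) = ℤ.∣ ↥ x ∣ * k

numerator-times-multiple : ∀ n k d-1 {D} → D ≡ k * suc d-1 → (+ n *ᶻ + D) *ᶻ + 1 ≡ + (n * k) *ᶻ + (suc d-1 * 1)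
numerator-times-multiple n k d-1 {D} D≡k*d = begin
  (+ n *ᶻ + D) *ᶻ + 1           ≡⟨ ℤ.*-identityʳ _ ⟩
  + n *ᶻ + D                    ≡⟨ ℤ.pos-* n D ⟨
  + (n * D)                     ≡⟨ cong (λ m → + (n * m)) D≡k*d ⟩
  + (n * (k * suc d-1))         ≡⟨ cong +_ (sym (ℕ.*-assoc n k (suc d-1))) ⟩
  + (n * k * suc d-1)           ≡⟨ ℤ.pos-* (n * k) (suc d-1) ⟩
  + (n * k) *ᶻ + suc d-1        ≡⟨ cong (λ m → + (n * k) *ᶻ + m) (ℕ.*-identityʳ (suc d-1)) ⟨
  + (n * k) *ᶻ + (suc d-1 * 1)  ∎
  where open ≡-Reasoning

scaleℕ-correct : ∀ x D (↧x∣D : ↧ₙ x ∣ D) → 0ℚ ℚ.≤ x → x ℚ.* ι (+ D) ≡ ι (+ scaleℕ x D ↧x∣D)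
scaleℕ-correct x@(mkℚ (+ n) d-1 _) D (divides k D≡k*d) _ = ℚ.toℚᵘ-injective (begin
  toℚᵘ (x ℚ.* ι (+ D))            ≈⟨ ℚ.toℚᵘ-homo-* x (ι (+ D)) ⟩
  toℚᵘ x ℚᵘ.* toℚᵘ (ι (+ D))      ≈⟨ ℚᵘ.*-congˡ {toℚᵘ x} (toℚᵘ-ι (+ D)) ⟩
  mkℚᵘ (+ n) d-1 ℚᵘ.* mkℚᵘ (+ D) 0 ≈⟨ *≡* (numerator-times-multiple n k d-1 D≡k*d) ⟩
  mkℚᵘ (+ (n * k)) 0              ≈⟨ toℚᵘ-ι (+ (n * k)) ⟨
  toℚᵘ (ι (+ (n * k)))            ∎)
  where open ℚᵘ.≃-Reasoning
scaleℕ-correct (mkℚ -[1+ _ ] _ _) D _ (ℚ.*≤* ())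

scaleℕ-0 : ∀ x D (↧x∣D : ↧ₙ x ∣ D) → x ≡ 0ℚ → scaleℕ x D ↧x∣D ≡ 0
scaleℕ-0 x D (divides k _) refl = refl

scaleℕ≡0⇒≡0 : ∀ x D (↧x∣D : ↧ₙ x ∣ D) → D ≢ 0 → scaleℕ x D ↧x∣D ≡ 0 → x ≡ 0ℚ
scaleℕ≡0⇒≡0 x D (divides zero D≡0) D≢0 _ = contradiction D≡0 D≢0
scaleℕ≡0⇒≡0 x@(mkℚ n _ _) D (divides (suc k) _) _ ∣n∣*k≡0 = ℚ.≃⇒≡ (ℚ.*≡* (trans (ℤ.*-identityʳ n) n≡0))
  where
  n≡0 : n ≡ + 0
  n≡0 = ℤ.∣i∣≡0⇒i≡0 (ℕ.m*n≡0⇒m≡0 (ℤ.∣ n ∣) (suc k) ∣n∣*k≡0)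

∣-∏ : ∀ {n} (f : Fin n → ℕ) i → f i ∣ ∏ f
∣-∏ f Fin.zero    = m∣m*n _
∣-∏ f (Fin.suc i) = ∣-trans (∣-∏ (f ∘ Fin.suc) i) (n∣m*n (f Fin.zero))

*≢0 : ∀ {m n} → m ≢ 0 → n ≢ 0 → m * n ≢ 0
*≢0 {m} m≢0 n≢0 m*n≡0 = [ m≢0 , n≢0 ]′ (ℕ.m*n≡0⇒m≡0∨n≡0 m m*n≡0)

∏≢0 : ∀ {n} (f : Fin n → ℕ) → (∀ i → f i ≢ 0) → ∏ f ≢ 0
∏≢0 {zero}  f f≢0 ()
∏≢0 {suc n} f f≢0 = *≢0 (f≢0 Fin.zero) (∏≢0 (f ∘ Fin.suc) (f≢0 ∘ Fin.suc))

sumᶻ-linear : ∀ {n} α β (f g : Fin n → ℤ) →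
              sumᶻ (λ m → α *ᶻ f m +ᶻ β *ᶻ g m) ≡ α *ᶻ sumᶻ f +ᶻ β *ᶻ sumᶻ g
sumᶻ-linear α β f g = trans (∑-distrib-+ᶻ (λ m → α *ᶻ f m) (λ m → β *ᶻ g m))
                            (sym (cong₂ _+ᶻ_ (*-distribˡ-sumᶻ α f) (*-distribˡ-sumᶻ β g)))

nonneg-combination : ∀ {α β D Qb w} (z : ℤ) → β < D → D * Qb ≤ α → ℤ.∣ z ∣ ≤ Qb → (z ≢ 0ℤ → 1 ≤ w) →
                     Σ ℕ λ c → + α *ᶻ + w +ᶻ + β *ᶻ z ≡ + c
nonneg-combination {α} {β} {w = w} (+ z) _ _ _ _ =
  α * w + β * z , sym (trans (ℤ.pos-+ (α * w) (β * z)) (cong₂ _+ᶻ_ (ℤ.pos-* α w) (ℤ.pos-* β z)))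
nonneg-combination {α} {β} {w = w} -[1+ z-1 ] β<D DQb≤α ∣z∣≤Qb z≢0⇒1≤w = α * w ∸ β * suc z-1 , (begin
  + α *ᶻ + w +ᶻ + β *ᶻ -[1+ z-1 ]       ≡⟨ cong₂ _+ᶻ_ (ℤ.pos-* α w) (ℤ.neg-distribʳ-* (+ β) (+ suc z-1)) ⟨
  + (α * w) +ᶻ ℤ.- (+ β *ᶻ + suc z-1)   ≡⟨ cong (λ x → + (α * w) +ᶻ ℤ.- x) (ℤ.pos-* β (suc z-1)) ⟨
  + (α * w) +ᶻ ℤ.- + (β * suc z-1)      ≡⟨ ℤ.m-n≡m⊖n (α * w) (β * suc z-1) ⟩
  (α * w) ℤ.⊖ (β * suc z-1)             ≡⟨ ℤ.⊖-≥ βz≤αw ⟩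
  + (α * w ∸ β * suc z-1)               ∎)
  where
  open ≡-Reasoning
  -- β ∣z∣ < D Qb ≤ α ≤ α w, since z ≠ 0 forces w ≥ 1
  βz≤αw : β * suc z-1 ≤ α * w
  βz≤αw = ℕ.≤-trans (ℕ.*-mono-≤ (ℕ.<⇒≤ β<D) ∣z∣≤Qb)
            (ℕ.≤-trans DQb≤α (ℕ.≤-trans (ℕ.≤-reflexive (sym (ℕ.*-identityʳ α))) (ℕ.*-monoʳ-≤ α (z≢0⇒1≤w λ ()))))

-- A polymorphism is applied to whole columns, so the pointwise Vec.lookup∘tabulate does not suffice
-- without function extensionality.
apply-lookup∘tabulate : ∀ {Z W : Set} {n L} (f : (Fin L → Z) → W) (G : Fin n → Fin L → Z) t →
                        f (λ l → lookup (Vec.tabulate (λ s → G s l)) t) ≡ f (G t)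
apply-lookup∘tabulate f G Fin.zero    = refl
apply-lookup∘tabulate f G (Fin.suc t) = apply-lookup∘tabulate f (G ∘ Fin.suc) t

natural-sum : ∀ {n} (g : Fin n → ℕ) {k} → sumᶻ (λ m → + g m) ≡ + k → sum g ≡ k
natural-sum g Σg≡k = ℤ.+-injective (trans (pos-sum g) Σg≡k)

HasWideBlockSymmetricPolymorphisms : ∀ {τ} → Structure τ → Structure τ → Set
HasWideBlockSymmetricPolymorphisms A B =
  ∀ N → ∃ λ L → Σ ((Fin L → Dom A) → Dom B) λ f → IsPolymorphism A B L f × WidthAtLeast f N

module _ {τ : Signature} (X : Instance {τ}) (A : Structure τ) where

  open Enumeration {τ}

  record IsAffSolutionOfMass (k : ℤ) (r : WVars X A ℤ) (q : PVars X A ℤ) : Set where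
    field
      vanishes : ∀ j y → ¬ rel A (symbolOf X j) y → q j y ≡ + 0
      varMass  : ∀ i → sumᶻ (r i) ≡ k
      conMass  : ∀ j → sumᶻ (λ m → q j (vecAt m)) ≡ k
      marginal : ∀ j t a → sumᶻ (λ m → + δ (lookup (vecAt m) t) a *ᶻ q j (vecAt m)) ≡ r (lookup (scope X j) t) a

  -- IsAffSolution X A r q is, by definition, ListSumsOfMass (+ 1) r q.
  ListSumsOfMass : ℤ → WVars X A ℤ → PVars X A ℤ → Set
  ListSumsOfMass k r q =
      (∀ j y → ¬ rel A (symbolOf X j) y → q j y ≡ + 0)
    × (∀ i → sumℤ {τ} (map (r i) (allFin (size A))) ≡ k)
    × (∀ j → sumℤ {τ} (map (q j) (tuples X A (symbolOf X j))) ≡ k)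
    × (∀ j t a → sumℤ {τ} (map (q j) (tuplesAt X A (symbolOf X j) t a)) ≡ r (lookup (scope X j) t) a)

  listSums⇔mass : ∀ {k r q} → ListSumsOfMass k r q ⇔ IsAffSolutionOfMass k r q
  listSums⇔mass {k} {r} {q} = mk⇔ to from
    where
    Vanishes : Set
    Vanishes = ∀ j y → ¬ rel A (symbolOf X j) y → q j y ≡ + 0
    tuples≡ : Vanishes → ∀ j → sumℤ {τ} (map (q j) (tuples X A (symbolOf X j))) ≡ sumᶻ (λ m → q j (vecAt m))
    tuples≡ vanish j = sumℤ-tuples X A (symbolOf X j) (q j) (vanish j)
    tuplesAt≡ : Vanishes → ∀ j t a → sumℤ {τ} (map (q j) (tuplesAt X A (symbolOf X j) t a)) ≡
                                      sumᶻ (λ m → + δ (lookup (vecAt m) t) a *ᶻ q j (vecAt m))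
    tuplesAt≡ vanish j = sumℤ-tuplesAt X A (symbolOf X j) (q j) (vanish j)
    to : ListSumsOfMass k r q → IsAffSolutionOfMass k r q
    to (vanish , var , con , marg) = record
      { vanishes = vanish
      ; varMass  = λ i → trans (sym (sumℤ-allFin {τ} (r i))) (var i)
      ; conMass  = λ j → trans (sym (tuples≡ vanish j)) (con j)
      ; marginal = λ j t a → trans (sym (tuplesAt≡ vanish j t a)) (marg j t a)
      }
    from : IsAffSolutionOfMass k r q → ListSumsOfMass k r q
    from s = vanishes
           , (λ i → trans (sumℤ-allFin {τ} (r i)) (varMass i))
           , (λ j → trans (tuples≡ vanishes j) (conMass j))
           , (λ j t a → trans (tuplesAt≡ vanishes j t a) (marginal j t a))
      where open IsAffSolutionOfMass s

  mass-cong : ∀ {k k′ r r′ q q′} → k ≡ k′ → (∀ i a → r i a ≡ r′ i a) → (∀ j y → q j y ≡ q′ j y) →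
              IsAffSolutionOfMass k r q → IsAffSolutionOfMass k′ r′ q′
  mass-cong {q = q} {q′} k≡k′ r≗r′ q≗q′ s = record
    { vanishes = λ j y ¬R → trans (sym (q≗q′ j y)) (vanishes j y ¬R)
    ; varMass  = λ i → trans (sum-cong-≗ᶻ (λ a → sym (r≗r′ i a))) (trans (varMass i) k≡k′)
    ; conMass  = λ j → trans (sum-cong-≗ᶻ (λ m → sym (q≗q′ j (vecAt m)))) (trans (conMass j) k≡k′)
    ; marginal = λ j t a → trans (sum-cong-≗ᶻ (λ m → cong (+ δ (lookup (vecAt m) t) a *ᶻ_) (sym (q≗q′ j (vecAt m)))))
                                 (trans (marginal j t a) (r≗r′ (lookup (scope X j) t) a))
    }
    where open IsAffSolutionOfMass s

  mass-combination : ∀ {k k′ r r′ q q′} α β → IsAffSolutionOfMass k r q → IsAffSolutionOfMass k′ r′ q′ →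
                     IsAffSolutionOfMass (α *ᶻ k +ᶻ β *ᶻ k′)
                                         (λ i a → α *ᶻ r i a +ᶻ β *ᶻ r′ i a) (λ j y → α *ᶻ q j y +ᶻ β *ᶻ q′ j y)
  mass-combination {k} {k′} {r} {r′} {q} {q′} α β s s′ = record
    { vanishes = λ j y ¬R → begin
        α *ᶻ q j y +ᶻ β *ᶻ q′ j y ≡⟨ cong₂ (λ u v → α *ᶻ u +ᶻ β *ᶻ v) (S.vanishes j y ¬R) (S′.vanishes j y ¬R) ⟩
        α *ᶻ 0ℤ +ᶻ β *ᶻ 0ℤ         ≡⟨ cong₂ _+ᶻ_ (ℤ.*-zeroʳ α) (ℤ.*-zeroʳ β) ⟩
        0ℤ                          ∎
    ; varMass  = λ i → trans (sumᶻ-linear α β (r i) (r′ i))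
                             (cong₂ (λ u v → α *ᶻ u +ᶻ β *ᶻ v) (S.varMass i) (S′.varMass i))
    ; conMass  = λ j → trans (sumᶻ-linear α β (q j ∘ vecAt) (q′ j ∘ vecAt))
                             (cong₂ (λ u v → α *ᶻ u +ᶻ β *ᶻ v) (S.conMass j) (S′.conMass j))
    ; marginal = λ j t a → begin
        sumᶻ (λ m → e t a m *ᶻ (α *ᶻ q j (vecAt m) +ᶻ β *ᶻ q′ j (vecAt m)))
          ≡⟨ sum-cong-≗ᶻ (λ m → distrib (e t a m) α β (q j (vecAt m)) (q′ j (vecAt m))) ⟩
        sumᶻ (λ m → α *ᶻ (e t a m *ᶻ q j (vecAt m)) +ᶻ β *ᶻ (e t a m *ᶻ q′ j (vecAt m)))
          ≡⟨ sumᶻ-linear α β (λ m → e t a m *ᶻ q j (vecAt m)) (λ m → e t a m *ᶻ q′ j (vecAt m)) ⟩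
        α *ᶻ sumᶻ (λ m → e t a m *ᶻ q j (vecAt m)) +ᶻ β *ᶻ sumᶻ (λ m → e t a m *ᶻ q′ j (vecAt m))
          ≡⟨ cong₂ (λ u v → α *ᶻ u +ᶻ β *ᶻ v) (S.marginal j t a) (S′.marginal j t a) ⟩
        α *ᶻ r (lookup (scope X j) t) a +ᶻ β *ᶻ r′ (lookup (scope X j) t) a ∎
    }
    where
    open ≡-Reasoning
    module S = IsAffSolutionOfMass s
    module S′ = IsAffSolutionOfMass s′
    e : ∀ {j} t a → Fin (nVecs (size A) (ar τ (symbolOf X j))) → ℤ
    e t a m = + δ (lookup (vecAt m) t) a
    distrib : ∀ x α β u v → x *ᶻ (α *ᶻ u +ᶻ β *ᶻ v) ≡ α *ᶻ (x *ᶻ u) +ᶻ β *ᶻ (x *ᶻ v)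
    distrib = ℤ-RingSolver.solve-∀

  nonnegAff⇒LP : ∀ {r : WVars X A ℕ} {q : PVars X A ℕ} →
                 IsAffSolution X A (λ i a → + r i a) (λ j y → + q j y) →
                 IsLPSolution X A (λ i a → ι (+ r i a)) (λ j y → ι (+ q j y))
  nonnegAff⇒LP {r} {q} (vanish , var , con , marg) =
      (λ i a → 0≤ι (r i a))
    , (λ j y → 0≤ι (q j y))
    , (λ j y ¬R → cong ι (vanish j y ¬R))
    , (λ i → trans (sumℚ-ι {τ} (λ a → + r i a) (allFin (size A))) (cong ι (var i)))
    , (λ j → trans (sumℚ-ι {τ} (λ y → + q j y) (tuples X A (symbolOf X j))) (cong ι (con j)))
    , (λ j t a → trans (sumℚ-ι {τ} (λ y → + q j y) (tuplesAt X A (symbolOf X j) t a)) (cong ι (marg j t a)))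

  module _ (σ : Fin (nvars X) → Dom A) (σ-sat : ∀ j → rel A (symbolOf X j) (Vec.map σ (scope X j))) where

    indicatorW : WVars X A ℕ
    indicatorW i a = δ (σ i) a

    indicatorP : PVars X A ℕ
    indicatorP j y = δ y (Vec.map σ (scope X j))

    indicator-mass : IsAffSolutionOfMass (+ 1) (λ i a → + indicatorW i a) (λ j y → + indicatorP j y)
    indicator-mass = record
      { vanishes = λ j y ¬R → cong +_ (δ-≢ λ y≡σx → ¬R (subst (rel A (symbolOf X j)) (sym y≡σx) (σ-sat j)))
      ; varMass  = λ i → trans (sym (pos-sum (δ (σ i)))) (cong +_ (sum-δ-1 (σ i)))
      ; conMass  = λ j → trans (sym (pos-sum (λ m → indicatorP j (vecAt m)))) (cong +_ (count-vecAt (Vec.map σ (scope X j))))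
      ; marginal = marginal
      }
      where
      marginal : ∀ j t a → sumᶻ (λ m → + δ (lookup (vecAt m) t) a *ᶻ + indicatorP j (vecAt m)) ≡
                           + indicatorW (lookup (scope X j) t) a
      marginal j t a = begin
        sumᶻ (λ m → + δ (lookup (vecAt m) t) a *ᶻ + δ (vecAt m) y₀)
          ≡⟨ sum-cong-≗ᶻ (λ m → trans (ℤ.*-comm (+ δ (lookup (vecAt m) t) a) (+ δ (vecAt m) y₀))
                                      (sym (ℤ.pos-* (δ (vecAt m) y₀) (δ (lookup (vecAt m) t) a)))) ⟩
        sumᶻ (λ m → + (δ (vecAt m) y₀ * δ (lookup (vecAt m) t) a))
          ≡⟨ pos-sum (λ m → δ (vecAt m) y₀ * δ (lookup (vecAt m) t) a) ⟨
        + sum (λ m → δ (vecAt m) y₀ * δ (lookup (vecAt m) t) a)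
          ≡⟨ cong +_ (sum-vecAt-δ y₀ (λ y → δ (lookup y t) a)) ⟩
        + δ (lookup y₀ t) a
          ≡⟨ cong (λ b → + δ b a) (Vec.lookup-map t σ (scope X j)) ⟩
        + δ (σ (lookup (scope X j) t)) a ∎
        where
        open ≡-Reasoning
        y₀ : Vec (Dom A) (ar τ (symbolOf X j))
        y₀ = Vec.map σ (scope X j)

    indicator-aff : IsAffSolution X A (λ i a → + indicatorW i a) (λ j y → + indicatorP j y)
    indicator-aff = Equivalence.from listSums⇔mass indicator-mass

    indicator-lp : IsLPSolution X A (λ i a → ι (+ indicatorW i a)) (λ j y → ι (+ indicatorP j y))
    indicator-lp = nonnegAff⇒LP indicator-aff

    indicator-restricted : ∀ w p → IsRelIntPoint X A w p → AffRestrictedSolvable X A w p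
    indicator-restricted w p (_ , w-relint , p-relint) = _ , _ , indicator-aff , w-support , p-support
      where
      w-support : ∀ i a → w i a ≡ 0ℚ → + indicatorW i a ≡ + 0
      w-support i a w≡0 with σ i Fin.≟ a
      ... | no _ = refl
      ... | yes refl = contradiction (proj₂ (w-relint i a) (_ , _ , indicator-lp , positive)) (ℚ.<-irrefl (sym w≡0))
        where
        positive : 0ℚ ℚ.< ι (+ indicatorW i a)
        positive = subst (λ n → 0ℚ ℚ.< ι (+ n)) (sym (δ-refl (σ i))) 0<ι1
      p-support : ∀ j y → p j y ≡ 0ℚ → + indicatorP j y ≡ + 0
      p-support j y p≡0 with y ≟ Vec.map σ (scope X j)
      ... | no _ = refl
      ... | yes refl = contradiction (proj₂ (p-relint j y) (_ , _ , indicator-lp , positive)) (ℚ.<-irrefl (sym p≡0))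
        where
        positive : 0ℚ ℚ.< ι (+ indicatorP j y)
        positive = subst (λ n → 0ℚ ℚ.< ι (+ n)) (sym (δ-refl y)) 0<ι1

  satisfiable⇒accepted : SatisfiableIn X A →
                         LPFeasible X A × (∀ w p → IsRelIntPoint X A w p → AffRestrictedSolvable X A w p)
  satisfiable⇒accepted (σ , σ-sat) = (_ , _ , indicator-lp σ σ-sat) , indicator-restricted σ σ-sat

  record IntegralScaling (w : WVars X A ℚ) (p : PVars X A ℚ) : Set where
    field
      D       : ℕ
      D≢0     : D ≢ 0
      W       : WVars X A ℕ
      P       : PVars X A ℕ
      mass    : IsAffSolutionOfMass (+ D) (λ i a → + W i a) (λ j y → + P j y)
      W≡0⇒w≡0 : ∀ i a → W i a ≡ 0 → w i a ≡ 0ℚ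
      P≡0⇒p≡0 : ∀ j y → P j y ≡ 0 → p j y ≡ 0ℚ

  lpSolution⇒integralScaling : ∀ {w p} → IsLPSolution X A w p → IntegralScaling w p
  lpSolution⇒integralScaling {w} {p} (w≥0 , p≥0 , p-vanish , w-sum , p-sum , p-marg) = record
    { D       = D
    ; D≢0     = D≢0
    ; W       = W
    ; P       = P
    ; mass    = Equivalence.to listSums⇔mass
                  ( (λ j y ¬R → cong +_ (scaleℕ-0 (p j y) D (↧p∣D j y) (p-vanish j y ¬R)))
                  , (λ i → sumℤ-scaled {τ} (ι (+ D)) (w i) (λ a → + W i a) (W-correct i) (allFin (size A))
                             (w-sum i) (ℚ.*-identityˡ (ι (+ D))))
                  , (λ j → sumℤ-scaled {τ} (ι (+ D)) (p j) (λ y → + P j y) (P-correct j) (tuples X A (symbolOf X j))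
                             (p-sum j) (ℚ.*-identityˡ (ι (+ D))))
                  , (λ j t a → sumℤ-scaled {τ} (ι (+ D)) (p j) (λ y → + P j y) (P-correct j) (tuplesAt X A (symbolOf X j) t a)
                                 (p-marg j t a) (W-correct (lookup (scope X j) t) a)) )
    ; W≡0⇒w≡0 = λ i a → scaleℕ≡0⇒≡0 (w i a) D (↧w∣D i a) D≢0
    ; P≡0⇒p≡0 = λ j y → scaleℕ≡0⇒≡0 (p j y) D (↧p∣D j y) D≢0
    }
    where
    Dw Dp D : ℕ
    Dw = ∏ (λ i → ∏ (λ a → ↧ₙ w i a))
    Dp = ∏ (λ j → ∏ (λ m → ↧ₙ p j (vecAt m)))
    D  = Dw * Dp
    D≢0 : D ≢ 0
    D≢0 = *≢0 (∏≢0 _ λ i → ∏≢0 (λ a → ↧ₙ w i a) λ _ ())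
              (∏≢0 _ λ j → ∏≢0 (λ m → ↧ₙ p j (vecAt m)) λ _ ())
    ↧w∣D : ∀ i a → ↧ₙ w i a ∣ D
    ↧w∣D i a = ∣-trans (∣-trans (∣-∏ _ a) (∣-∏ _ i)) (m∣m*n Dp)
    ↧p∣D : ∀ j y → ↧ₙ p j y ∣ D
    ↧p∣D j y with vecAt-surjective y
    ... | m , refl = ∣-trans (∣-trans (∣-∏ _ m) (∣-∏ _ j)) (n∣m*n Dw)
    W : WVars X A ℕ
    W i a = scaleℕ (w i a) D (↧w∣D i a)
    P : PVars X A ℕ
    P j y = scaleℕ (p j y) D (↧p∣D j y)
    W-correct : ∀ i a → w i a ℚ.* ι (+ D) ≡ ι (+ W i a)
    W-correct i a = scaleℕ-correct (w i a) D (↧w∣D i a) (w≥0 i a)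
    P-correct : ∀ j y → p j y ℚ.* ι (+ D) ≡ ι (+ P j y)
    P-correct j y = scaleℕ-correct (p j y) D (↧p∣D j y) (p≥0 j y)

  large-mass-solutions :
    ∀ {D} {W : WVars X A ℕ} {P : PVars X A ℕ} {r : WVars X A ℤ} {q : PVars X A ℤ} → D ≢ 0 →
    IsAffSolutionOfMass (+ D) (λ i a → + W i a) (λ j y → + P j y) → IsAffSolutionOfMass (+ 1) r q →
    (∀ i a → r i a ≢ 0ℤ → 1 ≤ W i a) → (∀ j y → q j y ≢ 0ℤ → 1 ≤ P j y) →
    ∃ λ N → ∀ n → N ≤ n →
      Σ (WVars X A ℕ) λ ω → Σ (PVars X A ℕ) λ c → IsAffSolutionOfMass (+ n) (λ i a → + ω i a) (λ j y → + c j y)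
  large-mass-solutions {D} {W} {P} {r} {q} D≢0 scaled affine r≢0⇒1≤W q≢0⇒1≤P = D * Qb * D , solution
    where
    instance
      D-nonZero : ℕ.NonZero D
      D-nonZero = ℕ.≢-nonZero D≢0
    Qb : ℕ
    Qb = sum (λ i → sum (λ a → ℤ.∣ r i a ∣)) + sum (λ j → sum (λ m → ℤ.∣ q j (vecAt m) ∣))
    r-bound : ∀ i a → ℤ.∣ r i a ∣ ≤ Qb
    r-bound i a = ℕ.≤-trans (summand≤sum (λ a → ℤ.∣ r i a ∣) a)
                    (ℕ.≤-trans (summand≤sum (λ i → sum (λ a → ℤ.∣ r i a ∣)) i) (ℕ.m≤m+n _ _))
    q-bound : ∀ j y → ℤ.∣ q j y ∣ ≤ Qb
    q-bound j y with vecAt-surjective y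
    ... | m , refl = ℕ.≤-trans (summand≤sum (λ m → ℤ.∣ q j (vecAt m) ∣) m)
                       (ℕ.≤-trans (summand≤sum (λ j → sum (λ m → ℤ.∣ q j (vecAt m) ∣)) j) (ℕ.m≤n+m _ _))
    solution : ∀ n → D * Qb * D ≤ n →
      Σ (WVars X A ℕ) λ ω → Σ (PVars X A ℕ) λ c → IsAffSolutionOfMass (+ n) (λ i a → + ω i a) (λ j y → + c j y)
    solution n N≤n = ω , c , mass-cong n≡αD+β ω-correct c-correct (mass-combination (+ α) (+ β) scaled affine)
      where
      α β : ℕ
      α = n ℕ./ D
      β = n ℕ.% D
      DQb≤α : D * Qb ≤ α
      DQb≤α = ℕ.≤-trans (ℕ.≤-reflexive (sym (DivMod.m*n/n≡m (D * Qb) D))) (DivMod./-monoˡ-≤ D N≤n)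
      n≡αD+β : + α *ᶻ + D +ᶻ + β *ᶻ + 1 ≡ + n
      n≡αD+β = begin
        + α *ᶻ + D +ᶻ + β *ᶻ + 1 ≡⟨ cong₂ _+ᶻ_ (ℤ.pos-* α D) (sym (ℤ.*-identityʳ (+ β))) ⟨
        + (α * D) +ᶻ + β          ≡⟨ ℤ.pos-+ (α * D) β ⟨
        + (α * D + β)             ≡⟨ cong +_ (ℕ.+-comm (α * D) β) ⟩
        + (β + α * D)             ≡⟨ cong +_ (DivMod.m≡m%n+[m/n]*n n D) ⟨
        + n                       ∎
        where open ≡-Reasoning
      ω-entry : ∀ i a → Σ ℕ λ x → + α *ᶻ + W i a +ᶻ + β *ᶻ r i a ≡ + x
      ω-entry i a = nonneg-combination (r i a) (DivMod.m%n<n n D) DQb≤α (r-bound i a) (r≢0⇒1≤W i a)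
      c-entry : ∀ j y → Σ ℕ λ x → + α *ᶻ + P j y +ᶻ + β *ᶻ q j y ≡ + x
      c-entry j y = nonneg-combination (q j y) (DivMod.m%n<n n D) DQb≤α (q-bound j y) (q≢0⇒1≤P j y)
      ω : WVars X A ℕ
      ω i a = proj₁ (ω-entry i a)
      ω-correct : ∀ i a → + α *ᶻ + W i a +ᶻ + β *ᶻ r i a ≡ + ω i a
      ω-correct i a = proj₂ (ω-entry i a)
      c : PVars X A ℕ
      c j y = proj₁ (c-entry j y)
      c-correct : ∀ j y → + α *ᶻ + P j y +ᶻ + β *ᶻ q j y ≡ + c j y
      c-correct j y = proj₂ (c-entry j y)

  module Blockwise (B : Structure τ) {L K} (f : (Fin L → Dom A) → Dom B) (blk : Fin L → Fin K)
                   (f-pol : IsPolymorphism A B L f) (f-sym : IsBlockSymmetric f blk)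
                   (ω : Fin K → WVars X A ℕ) (c : Fin K → PVars X A ℕ)
                   (solution : ∀ b → IsAffSolutionOfMass (+ count blk b) (λ i a → + ω b i a) (λ j y → + c b j y))
                   where

    private module S b = IsAffSolutionOfMass (solution b)

    columnOf : ∀ i → Σ (Fin L → Dom A) λ col → ∀ b a → count (λ l → blk l , col l) (b , a) ≡ ω b i a
    columnOf i = realise-joint-counts blk (λ b → ω b i) (λ b → natural-sum (ω b i) (S.varMass b i))

    column : Fin (nvars X) → Fin L → Dom A
    column i = proj₁ (columnOf i)

    σ : Fin (nvars X) → Dom B
    σ i = f (column i)

    module _ (j : Fin (ncons X)) where

      private
        R : Sym τ
        R = symbolOf X j
        x : Vec (Fin (nvars X)) (ar τ R)
        x = scope X j

      rowOf : Σ (Fin L → Fin (nVecs (size A) (ar τ R))) λ row →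
              ∀ b m → count (λ l → blk l , row l) (b , m) ≡ c b j (vecAt m)
      rowOf = realise-joint-counts blk (λ b m → c b j (vecAt m)) (λ b → natural-sum (λ m → c b j (vecAt m)) (S.conMass b j))

      row : Fin L → Fin (nVecs (size A) (ar τ R))
      row = proj₁ rowOf

      entry-counts : ∀ t b a → count (λ l → blk l , lookup (vecAt (row l)) t) (b , a) ≡ ω b (lookup x t) a
      entry-counts t b a = begin
        count (λ l → blk l , lookup (vecAt (row l)) t) (b , a)
          ≡⟨ joint-count-∘ blk row (λ m → lookup (vecAt m) t) b a ⟩
        sum (λ m → δ (lookup (vecAt m) t) a * count (λ l → blk l , row l) (b , m))
          ≡⟨ sum-cong-≗ (λ m → cong (δ (lookup (vecAt m) t) a *_) (proj₂ rowOf b m)) ⟩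
        sum (λ m → δ (lookup (vecAt m) t) a * c b j (vecAt m))
          ≡⟨ natural-sum (λ m → δ (lookup (vecAt m) t) a * c b j (vecAt m))
               (trans (sum-cong-≗ᶻ (λ m → ℤ.pos-* (δ (lookup (vecAt m) t) a) (c b j (vecAt m)))) (S.marginal b j t a)) ⟩
        ω b (lookup x t) a ∎
        where open ≡-Reasoning

      aligned : ∀ t → Σ (Permutation′ L) λ π →
                ∀ l → (blk (π ⟨$⟩ʳ l) , column (lookup x t) (π ⟨$⟩ʳ l)) ≡ (blk l , lookup (vecAt (row l)) t)
      aligned t = equal-counts⇒permutation (λ l → blk l , column (lookup x t) l) (λ l → blk l , lookup (vecAt (row l)) t)
                    λ (b , a) → trans (proj₂ (columnOf (lookup x t)) b a) (sym (entry-counts t b a))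

      matrix : Fin L → Vec (Dom A) (ar τ R)
      matrix l = Vec.tabulate (λ t → column (lookup x t) (proj₁ (aligned t) ⟨$⟩ʳ l))

      matrix≡row : ∀ l → matrix l ≡ vecAt (row l)
      matrix≡row l = trans (Vec.tabulate-cong (λ t → ,-injectiveʳ (proj₂ (aligned t) l))) (Vec.tabulate∘lookup (vecAt (row l)))

      rows∈R : ∀ l → rel A R (matrix l)
      rows∈R l = subst (rel A R) (sym (matrix≡row l)) (decidable-stable (rel? A R (vecAt (row l))) λ ¬R →
        ℕ.<⇒≢ (subst (1 ≤_) (proj₂ rowOf (blk l) (row l)) (count-self (λ l → blk l , row l) l))
              (sym (ℤ.+-injective (S.vanishes (blk l) j (vecAt (row l)) ¬R))))

      f-columns : ∀ t → f (λ l → lookup (matrix l) t) ≡ σ (lookup x t)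
      f-columns t = trans (apply-lookup∘tabulate f (λ t l → column (lookup x t) (proj₁ (aligned t) ⟨$⟩ʳ l)) t)
                          (f-sym (proj₁ (aligned t)) (λ l → ,-injectiveˡ (proj₂ (aligned t) l)) (column (lookup x t)))

      σ-sat : rel B R (Vec.map σ x)
      σ-sat = subst (rel B R) image≡σx (f-pol R matrix rows∈R)
        where
        image≡σx : Vec.tabulate (λ t → f (λ l → lookup (matrix l) t)) ≡ Vec.map σ x
        image≡σx = trans (Vec.tabulate-cong f-columns)
                         (trans (Vec.tabulate-∘ σ (lookup x)) (cong (Vec.map σ) (Vec.tabulate∘lookup x)))

  blockwise-solutions⇒satisfiable :
    ∀ (B : Structure τ) {L K} (f : (Fin L → Dom A) → Dom B) (blk : Fin L → Fin K) →
    IsPolymorphism A B L f → IsBlockSymmetric f blk →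
    (ω : Fin K → WVars X A ℕ) (c : Fin K → PVars X A ℕ) →
    (∀ b → IsAffSolutionOfMass (+ count blk b) (λ i a → + ω b i a) (λ j y → + c b j y)) →
    SatisfiableIn X B
  blockwise-solutions⇒satisfiable B f blk f-pol f-sym ω c solution = σ , σ-sat
    where open Blockwise B f blk f-pol f-sym ω c solution

  affRestricted⇒large-mass-solutions :
    ∀ {w p} → IsLPSolution X A w p → AffRestrictedSolvable X A w p →
    ∃ λ N → ∀ n → N ≤ n →
      Σ (WVars X A ℕ) λ ω → Σ (PVars X A ℕ) λ c → IsAffSolutionOfMass (+ n) (λ i a → + ω i a) (λ j y → + c j y)
  affRestricted⇒large-mass-solutions lp (r , q , aff , r-support , q-support) =
    large-mass-solutions D≢0 mass (Equivalence.to listSums⇔mass aff)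
      (λ i a r≢0 → ℕ.n≢0⇒n>0 (r≢0 ∘ r-support i a ∘ W≡0⇒w≡0 i a))
      (λ j y q≢0 → ℕ.n≢0⇒n>0 (q≢0 ∘ q-support j y ∘ P≡0⇒p≡0 j y))
    where open IntegralScaling (lpSolution⇒integralScaling lp)

  module _ (B : Structure τ) {N : ℕ}
           (solutions : ∀ n → N ≤ n → Σ (WVars X A ℕ) λ ω → Σ (PVars X A ℕ) λ c →
                                        IsAffSolutionOfMass (+ n) (λ i a → + ω i a) (λ j y → + c j y)) where

    wide-polymorphism⇒satisfiable : (∃ λ L → Σ ((Fin L → Dom A) → Dom B) λ f →
                                       IsPolymorphism A B L f × WidthAtLeast f N) →
                                    SatisfiableIn X B
    wide-polymorphism⇒satisfiable (L , f , f-pol , _ , blk , _ , f-sym , blocks-large) =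
      blockwise-solutions⇒satisfiable B f blk f-pol f-sym
        (proj₁ ∘ solution) (proj₁ ∘ proj₂ ∘ solution) (proj₂ ∘ proj₂ ∘ solution)
      where
      solution : ∀ b → Σ (WVars X A ℕ) λ ω → Σ (PVars X A ℕ) λ c →
                         IsAffSolutionOfMass (+ count blk b) (λ i a → + ω i a) (λ j y → + c j y)
      solution b = solutions (count blk b) (subst (N ≤_) (blockSize≡count blk b) (blocks-large b))

  affRestricted⇒satisfiable : ∀ B {w p} → HasWideBlockSymmetricPolymorphisms A B →
                              IsLPSolution X A w p → AffRestrictedSolvable X A w p → SatisfiableIn X B
  affRestricted⇒satisfiable B wide lp restricted =
    let N , solutions = affRestricted⇒large-mass-solutions lp restricted
    in wide-polymorphism⇒satisfiable B solutions (wide N)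

theorem4p1 : ∀ {τ : Signature} (A B : Structure τ) →
    IsPromiseTemplate A B →
    (∀ (N : ℕ) → ∃ λ (L : ℕ) → Σ ((Fin L → Dom A) → Dom B) λ f →
        IsPolymorphism A B L f × WidthAtLeast f N) →
    BLPAffSolves A B
theorem4p1 A B _ wide X =
    satisfiable⇒accepted X A
  , λ ¬sat w p (lp , _) restricted → ¬sat (affRestricted⇒satisfiable X A B wide lp restricted)
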